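{- Let $u$ be a seed in a cluster algebra $\mathcal{A}$ with exchange graph $\mathcal{E}_\mathcal{A}$, and let $\phi\in\operatorname{Aut}\mathcal{E}_\mathcal{A}$. For any two distinct vertices (cluster variables) $a,b$ of $u$, the geodesic loop $\mathcal{L}^{a,b}_u$ is isomorphic (as a graph) to the geodesic loop $\mathcal{L}^{\phi_v(a),\phi_v(b)}_{\phi(u)}$.
   Context: Seeds, mutations and cluster algebras: a labelled seed is a pair $(\mathbf{x},B)$ with $\mathbf{x}=(\beta_1,\dots,\beta_n)$ an ordered tuple of algebraically independent elements of $\mathbb{K}=\mathbb{C}(x_1,\dots,x_n)$ and $B=(b_{ij})$ an $n\times n$ skew-symmetrizable integer matrix; mutation $\mu_k$ replaces $\beta_k$ by $\big(\prod_{b_{jk}>0}\beta_j^{b_{jk}}+\prod_{b_{jk}<0}\beta_j^{ -b_{jk}}\big)/\beta_k$ and $B$ by $B'$ with $b'_{ij}=-b_{ij}$ if $i=k$ or $j=k$, $b'_{ij}=b_{ij}+\frac{|b_{ik}|b_{kj}+b_{ik}|b_{kj}|}{2}$ otherwise; permutations $\sigma$ act by relabelling indices. A seed is a labelled seed modulo permutations; its vertices are the indices/rows, identified with its cluster variables. The cluster algebra $\mathcal{A}$ is generated by all cluster variables in the mutation class $\mathcal{S}$. The exchange graph $\mathcal{E}_\mathcal{A}$ has vertices the seeds and edges between seeds related by one mutation; the labelled exchange graph $\Delta$ has vertices the labelled seeds and an edge labelled $i$ between $u$ and $u\cdot\mu_i$. Each $\phi\in\operatorname{Aut}\mathcal{E}_\mathcal{A}$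 induces a label-preserving automorphism $\phi^\Delta$ of $\Delta$ with $\pi(\phi^\Delta(\tilde u))=\phi(\pi(\tilde u))$ and $\pi(\phi^\Delta(\tilde u)\cdot\mu_k)=\phi(\pi(\tilde u\cdot\mu_k))$ for all labelled seeds $\tilde u$ and all $k$, where $\pi$ forgets the labelling; $\phi^\Delta$ commutes with permutations. The induced map $\phi_v$ from the cluster variables of $u$ to those of $\phi(u)$ sends the $i$-th cluster variable of a labelled representative $\tilde u$ of $u$ to the $i$-th cluster variable of $\phi^\Delta(\tilde u)$. For distinct vertices $a,b$ of a seed $u$, the geodesic loop $\mathcal{L}^{a,b}_u$ is the exchange graph of the cofrozenisation $u\backslash\{a,b\}$, i.e. of the seed $u$ in which all vertices except $a,b$ are frozen (only mutations at $a$ and $b$ and at the variables replacing them are allowed); it embeds into $\mathcal{E}_\mathcal{A}$ and is either a cycle with $4,5,6$ or $8$ edges or an infinite path. Standing assumption: the matrix of a seed is uniquely determined by its cluster. -}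

module Defs where

open import Data.Nat as ℕ using (ℕ; suc)
open import Data.Integer as ℤ using (ℤ; +_; -[1+_]; ∣_∣)
open import Data.Integer.DivMod using () renaming (_/_ to _divℤ_)
open import Data.Fin using (Fin; zero; suc)
open import Data.Fin.Permutation using (Permutation′; _⟨$⟩ʳ_)
open import Data.Product using (Σ; ∃; _×_; _,_; proj₁; proj₂)
open import Data.Sum using (_⊎_)
open import Data.List using (List; foldl; map)
open import Data.Bool using (Bool; if_then_else_)
open import Relation.Binary.PropositionalEquality using (_≡_; _≢_)
open import Relation.Nullary using (yes; no)
open import Data.Fin using (_≟_)

-- Elements of K = Q(x_1..x_n): subtraction-free rational expressions in
-- the variables x_i.  Every cluster variable is such an expression.

infixl 6 _⊕_
infixl 7 _⊗_ _⊘_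

data Expr (n : ℕ) : Set where
  var : Fin n → Expr n
  one : Expr n
  _⊕_ : Expr n → Expr n → Expr n
  _⊗_ : Expr n → Expr n → Expr n
  _⊘_ : Expr n → Expr n → Expr n

-- a positive rational number as (numerator , denominator), both positive
addF mulF divF : ℕ × ℕ → ℕ × ℕ → ℕ × ℕ
addF (p , q) (r , s) = (p ℕ.* s ℕ.+ r ℕ.* q) , (q ℕ.* s)
mulF (p , q) (r , s) = (p ℕ.* r) , (q ℕ.* s)
divF (p , q) (r , s) = (p ℕ.* s) , (q ℕ.* r)

-- evaluation at the point (pt i + 1)_i of the positive integer orthant
eval : ∀ {n} → (Fin n → ℕ) → Expr n → ℕ × ℕ
eval pt (var i) = suc (pt i) , 1
eval pt one     = 1 , 1
eval pt (e ⊕ f) = addF (eval pt e) (eval pt f)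
eval pt (e ⊗ f) = mulF (eval pt e) (eval pt f)
eval pt (e ⊘ f) = divF (eval pt e) (eval pt f)

-- equality in the field of rational functions: two subtraction-free
-- rational functions are equal iff they agree on all positive integer
-- points (this set is Zariski dense)
infix 4 _≈E_
_≈E_ : ∀ {n} → Expr n → Expr n → Set
e ≈E f = ∀ pt → proj₁ (eval pt e) ℕ.* proj₂ (eval pt f)
              ≡ proj₁ (eval pt f) ℕ.* proj₂ (eval pt e)

pow : ∀ {n} → Expr n → ℕ → Expr n
pow e ℕ.zero = one
pow e (suc m) = e ⊗ pow e m

prodF : ∀ {n} m → (Fin m → Expr n) → Expr n
prodF ℕ.zero f = one
prodF (suc m) f = f zero ⊗ prodF m (λ j → f (suc j))

posPart negPart : ℤ → ℕ
posPart (+ m)     = m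
posPart -[1+ m ]  = 0
negPart (+ m)     = 0
negPart -[1+ m ]  = suc m

Matrix : ℕ → Set
Matrix n = Fin n → Fin n → ℤ

SkewSymmetrizable : ∀ {n} → Matrix n → Set
SkewSymmetrizable {n} B =
  Σ (Fin n → ℕ) λ d → ∀ i j →
    (+ suc (d i)) ℤ.* B i j ≡ ℤ.- ((+ suc (d j)) ℤ.* B j i)

record LSeed (n : ℕ) : Set where
  constructor seed
  field
    clu : Fin n → Expr n
    mat : Matrix n
open LSeed public

mutMat : ∀ {n} → Fin n → Matrix n → Matrix n
mutMat k b i j with i ≟ k | j ≟ k
... | yes _ | _     = ℤ.- b i j
... | no _  | yes _ = ℤ.- b i j
... | no _  | no _  =
  b i j ℤ.+ ((+ ∣ b i k ∣ ℤ.* b k j ℤ.+ b i k ℤ.* + ∣ b k j ∣) divℤ (+ 2))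

mutClu : ∀ {n} → Fin n → LSeed n → Fin n → Expr n
mutClu {n} k s i with i ≟ k
... | no _  = clu s i
... | yes _ =
  (prodF n (λ j → pow (clu s j) (posPart (mat s j k)))
   ⊕ prodF n (λ j → pow (clu s j) (negPart (mat s j k))))
  ⊘ clu s k

mutate : ∀ {n} → Fin n → LSeed n → LSeed n
mutate k s = seed (mutClu k s) (mutMat k (mat s))

permute : ∀ {n} → Permutation′ n → LSeed n → LSeed n
permute σ s = seed (λ i → clu s (σ ⟨$⟩ʳ i))
                   (λ i j → mat s (σ ⟨$⟩ʳ i) (σ ⟨$⟩ʳ j))

mutateSeq : ∀ {n} → List (Fin n) → LSeed n → LSeed n
mutateSeq ks s = foldl (λ t k → mutate k t) s ks

infix 4 _≈L_
_≈L_ : ∀ {n} → LSeed n → LSeed n → Set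
s ≈L t = (∀ i → clu s i ≈E clu t i) × (∀ i j → mat s i j ≡ mat t i j)

-- equality of (unlabelled) seeds: labelled seeds modulo permutations
infix 4 _≃S_
_≃S_ : ∀ {n} → LSeed n → LSeed n → Set
s ≃S t = ∃ λ σ → t ≈L permute σ s

record Graph : Set₁ where
  field
    V    : Set
    _≈V_ : V → V → Set
    Adj  : V → V → Set
open Graph public

record Iso (G H : Graph) : Set where
  field
    to       : V G → V H
    from     : V H → V G
    to-cong  : ∀ {x y} → _≈V_ G x y → _≈V_ H (to x) (to y)
    from-cong : ∀ {x y} → _≈V_ H x y → _≈V_ G (from x) (from y)
    from-to  : ∀ x → _≈V_ G (from (to x)) x
    to-from  : ∀ y → _≈V_ H (to (from y)) y
    adj-to   : ∀ x y → Adj G x y → Adj H (to x) (to y)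
    adj-to⁻  : ∀ x y → Adj H (to x) (to y) → Adj G x y
open Iso public

module _ (n : ℕ) (B0 : Matrix n) where

  initSeed : LSeed n
  initSeed = seed var B0

  -- labelled seeds of the mutation class, given by a mutation sequence
  -- followed by a relabelling
  LVertex : Set
  LVertex = List (Fin n) × Permutation′ n

  seedOf : LVertex → LSeed n
  seedOf (ks , σ) = permute σ (mutateSeq ks initSeed)

  ExchangeGraph : Graph
  ExchangeGraph = record
    { V    = LVertex
    ; _≈V_ = λ v w → seedOf v ≃S seedOf w
    ; Adj  = λ v w → ∃ λ k → mutate k (seedOf v) ≃S seedOf w
    }

  StandingAssumption : Set
  StandingAssumption = ∀ (v w : LVertex) →
    (∀ i → clu (seedOf v) i ≈E clu (seedOf w) i) →
    ∀ i j → mat (seedOf v) i j ≡ mat (seedOf w) i j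

  -- φ^Δ : the induced label-preserving automorphism of the labelled
  -- exchange graph Δ, compatible with φ and commuting with permutations
  record InducedLift (φ : Iso ExchangeGraph ExchangeGraph) : Set where
    field
      Φ      : LVertex → LVertex
      Ψ      : LVertex → LVertex
      Φ-cong : ∀ v w → seedOf v ≈L seedOf w → seedOf (Φ v) ≈L seedOf (Φ w)
      Ψ-cong : ∀ v w → seedOf v ≈L seedOf w → seedOf (Ψ v) ≈L seedOf (Ψ w)
      ΨΦ     : ∀ v → seedOf (Ψ (Φ v)) ≈L seedOf v
      ΦΨ     : ∀ v → seedOf (Φ (Ψ v)) ≈L seedOf v
      Φ-edge : ∀ v w k → mutate k (seedOf v) ≈L seedOf w →
                 mutate k (seedOf (Φ v)) ≈L seedOf (Φ w)
      Φ-edge⁻ : ∀ v w k → mutate k (seedOf (Φ v)) ≈L seedOf (Φ w) →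
                 mutate k (seedOf v) ≈L seedOf w
      Φ-π    : ∀ v → seedOf (to φ v) ≃S seedOf (Φ v)
      Φ-πμ   : ∀ v w k → mutate k (seedOf v) ≈L seedOf w →
                 seedOf (to φ w) ≃S mutate k (seedOf (Φ v))
      Φ-perm : ∀ v w σ → permute σ (seedOf v) ≈L seedOf w →
                 permute σ (seedOf (Φ v)) ≈L seedOf (Φ w)

  -- the geodesic loop L^{a,b}_u : exchange graph of the cofrozenisation
  -- u \ {a,b}, where u is represented by the labelled seed seedOf v and
  -- a, b are its a-th and b-th cluster variables
  GeodesicLoop : LVertex → Fin n → Fin n → Graph
  GeodesicLoop v a b = record
    { V    = List Bool
    ; _≈V_ = λ p q → ∃ λ (σ : Permutation′ n) →
               (∀ i → i ≢ a → i ≢ b → σ ⟨$⟩ʳ i ≡ i) ×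
               (seedAt q ≈L permute σ (seedAt p))
    ; Adj  = λ p q → ∃ λ (σ : Permutation′ n) →
               (∀ i → i ≢ a → i ≢ b → σ ⟨$⟩ʳ i ≡ i) ×
               ((seedAt q ≈L permute σ (mutate a (seedAt p)))
                ⊎ (seedAt q ≈L permute σ (mutate b (seedAt p))))
    }
    where
      seedAt : List Bool → LSeed n
      seedAt p = mutateSeq (map (λ c → if c then a else b) p) (seedOf v)

-- The lift Φ of φ sends each labelled mutation edge to an edge with the same label and
-- commutes with relabellings, and it is invertible. Hence the seed reached from Φ u along
-- a mutation sequence is Φ of the seed reached from u along it, and two such seeds differ
-- by a relabelling σ exactly when their images under Φ do. A vertex of the geodesic loop
-- at u is a word in the labels a, b; as φ_v sends the a-th and b-th variables of u to the
-- a-th and b-th variables of Φ u, the loop at Φ u is indexed by the same words, and the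
-- identity on words is an isomorphism.
module Submission where

open import Defs
open import Algebra.Construct.DirectProduct using (commutativeMonoid)
import Algebra.Properties.CommutativeMonoid.Sum as CommutativeMonoidSum
open import Data.Bool using (Bool; if_then_else_)
open import Data.Empty using (⊥-elim)
open import Data.Fin using (Fin; zero; suc; _≟_)
open import Data.Fin.Permutation using (Permutation′; _⟨$⟩ʳ_; _∘ₚ_) renaming (id to idₚ)
open import Data.Integer as ℤ using (ℤ)
open import Data.List using (List; []; _∷_; _∷ʳ_; foldl; map)
open import Data.List.Properties using (foldl-∷ʳ)
open import Data.Nat using (ℕ; zero; suc; _*_; _+_; NonZero)
open import Data.Nat.Properties using (*-cancelʳ-≡; *-1-commutativeMonoid)
open import Data.Nat.Solver using (module +-*-Solver)
open import Data.Product using (∃₂; _×_; _,_; proj₁; proj₂)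
open import Data.Sum using (inj₁; inj₂)
open import Function using (_∘_; id)
open import Function.Bundles using (_⇔_; mk⇔; Equivalence; Injection)
open import Function.Construct.Composition using (_⇔-∘_)
open import Function.Properties.Inverse using (↔⇒↣)
open import Relation.Binary.Bundles using (Setoid)
import Relation.Binary.Reasoning.Setoid
open import Relation.Binary.PropositionalEquality
open import Relation.Nullary using (yes; no)
open +-*-Solver

-- (p , q) ≋ (r , s) says p/q = r/s, so e ≈E f is ∀ pt → eval pt e ≋ eval pt f.
infix 4 _≋_
_≋_ : ℕ × ℕ → ℕ × ℕ → Set
(p , q) ≋ (r , s) = p * s ≡ r * q

≋-trans : ∀ x y z .{{_ : NonZero (proj₂ y)}} → x ≋ y → y ≋ z → x ≋ z
≋-trans (p , q) (r , s) (t , u) ps≡rq ru≡ts = *-cancelʳ-≡ (p * u) (t * q) s (begin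
  p * u * s ≡⟨ swap p u s ⟩
  p * s * u ≡⟨ cong (_* u) ps≡rq ⟩
  r * q * u ≡⟨ swap r q u ⟩
  r * u * q ≡⟨ cong (_* q) ru≡ts ⟩
  t * s * q ≡⟨ swap t s q ⟩
  t * q * s ∎)
  where
  open ≡-Reasoning
  swap : ∀ x y z → x * y * z ≡ x * z * y
  swap = solve 3 (λ x y z → x :* y :* z := x :* z :* y) refl

addF-cong : ∀ {x y z w} → x ≋ y → z ≋ w → addF x z ≋ addF y w
addF-cong {p₁ , q₁} {p₂ , q₂} {r₁ , s₁} {r₂ , s₂} h k = begin
  (p₁ * s₁ + r₁ * q₁) * (q₂ * s₂)
    ≡⟨ lhs p₁ q₁ q₂ r₁ s₁ s₂ ⟩
  p₁ * q₂ * (s₁ * s₂) + r₁ * s₂ * (q₁ * q₂)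
    ≡⟨ cong₂ _+_ (cong (_* (s₁ * s₂)) h) (cong (_* (q₁ * q₂)) k) ⟩
  p₂ * q₁ * (s₁ * s₂) + r₂ * s₁ * (q₁ * q₂)
    ≡⟨ rhs p₂ q₁ q₂ r₂ s₁ s₂ ⟩
  (p₂ * s₂ + r₂ * q₂) * (q₁ * s₁)
    ∎
  where
  open ≡-Reasoning
  lhs : ∀ p q q′ r s s′ → (p * s + r * q) * (q′ * s′) ≡ p * q′ * (s * s′) + r * s′ * (q * q′)
  rhs : ∀ p q q′ r s s′ → p * q * (s * s′) + r * s * (q * q′) ≡ (p * s′ + r * q′) * (q * s)
  lhs = solve 6 (λ p q q′ r s s′ → (p :* s :+ r :* q) :* (q′ :* s′)
                                := p :* q′ :* (s :* s′) :+ r :* s′ :* (q :* q′)) refl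
  rhs = solve 6 (λ p q q′ r s s′ → p :* q :* (s :* s′) :+ r :* s :* (q :* q′)
                                := (p :* s′ :+ r :* q′) :* (q :* s)) refl

mulF-cong : ∀ {x y z w} → x ≋ y → z ≋ w → mulF x z ≋ mulF y w
mulF-cong {p₁ , q₁} {p₂ , q₂} {r₁ , s₁} {r₂ , s₂} h k = begin
  p₁ * r₁ * (q₂ * s₂) ≡⟨ interchange p₁ r₁ q₂ s₂ ⟩
  p₁ * q₂ * (r₁ * s₂) ≡⟨ cong₂ _*_ h k ⟩
  p₂ * q₁ * (r₂ * s₁) ≡⟨ interchange p₂ q₁ r₂ s₁ ⟩
  p₂ * r₂ * (q₁ * s₁) ∎
  where
  open ≡-Reasoning
  interchange : ∀ x y z w → x * y * (z * w) ≡ x * z * (y * w)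
  interchange = solve 4 (λ x y z w → x :* y :* (z :* w) := x :* z :* (y :* w)) refl

divF-cong : ∀ {x y z w} → x ≋ y → z ≋ w → divF x z ≋ divF y w
divF-cong {p₁ , q₁} {p₂ , q₂} {r₁ , s₁} {r₂ , s₂} h k = begin
  p₁ * s₁ * (q₂ * r₂) ≡⟨ lhs p₁ s₁ q₂ r₂ ⟩
  p₁ * q₂ * (r₂ * s₁) ≡⟨ cong₂ _*_ h (sym k) ⟩
  p₂ * q₁ * (r₁ * s₂) ≡⟨ rhs p₂ q₁ r₁ s₂ ⟩
  p₂ * s₂ * (q₁ * r₁) ∎
  where
  open ≡-Reasoning
  lhs : ∀ x y z w → x * y * (z * w) ≡ x * z * (w * y)
  rhs : ∀ x y z w → x * y * (z * w) ≡ x * w * (y * z)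
  lhs = solve 4 (λ x y z w → x :* y :* (z :* w) := x :* z :* (w :* y)) refl
  rhs = solve 4 (λ x y z w → x :* y :* (z :* w) := x :* w :* (y :* z)) refl

eval-positive : ∀ {n} pt (e : Expr n) → ∃₂ λ p q → eval pt e ≡ (suc p , suc q)
eval-positive pt (var i) = _ , 0 , refl
eval-positive pt one     = 0 , 0 , refl
eval-positive pt (e ⊕ f) with eval-positive pt e | eval-positive pt f
... | _ , _ , eq₁ | _ , _ , eq₂ rewrite eq₁ | eq₂ = _ , _ , refl
eval-positive pt (e ⊗ f) with eval-positive pt e | eval-positive pt f
... | _ , _ , eq₁ | _ , _ , eq₂ rewrite eq₁ | eq₂ = _ , _ , refl
eval-positive pt (e ⊘ f) with eval-positive pt e | eval-positive pt f
... | _ , _ , eq₁ | _ , _ , eq₂ rewrite eq₁ | eq₂ = _ , _ , refl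

≈E-trans : ∀ {n} {e f g : Expr n} → e ≈E f → f ≈E g → e ≈E g
≈E-trans {e = e} {f} {g} e≈f f≈g pt with eval-positive pt f
... | _ , _ , eq = ≋-trans (eval pt e) (eval pt f) (eval pt g)
                     {{subst (NonZero ∘ proj₂) (sym eq) _}} (e≈f pt) (f≈g pt)

⊕-cong : ∀ {n} {e e′ f f′ : Expr n} → e ≈E e′ → f ≈E f′ → e ⊕ f ≈E e′ ⊕ f′
⊕-cong {e = e} {e′} {f} {f′} h k pt =
  addF-cong {eval pt e} {eval pt e′} {eval pt f} {eval pt f′} (h pt) (k pt)

⊗-cong : ∀ {n} {e e′ f f′ : Expr n} → e ≈E e′ → f ≈E f′ → e ⊗ f ≈E e′ ⊗ f′
⊗-cong {e = e} {e′} {f} {f′} h k pt =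
  mulF-cong {eval pt e} {eval pt e′} {eval pt f} {eval pt f′} (h pt) (k pt)

⊘-cong : ∀ {n} {e e′ f f′ : Expr n} → e ≈E e′ → f ≈E f′ → e ⊘ f ≈E e′ ⊘ f′
⊘-cong {e = e} {e′} {f} {f′} h k pt =
  divF-cong {eval pt e} {eval pt e′} {eval pt f} {eval pt f′} (h pt) (k pt)

pow-cong : ∀ {n} {e f : Expr n} m → e ≈E f → pow e m ≈E pow f m
pow-cong zero    e≈f pt = refl
pow-cong {e = e} {f} (suc m) e≈f = ⊗-cong {e = e} {f} {pow e m} {pow f m} e≈f (pow-cong m e≈f)

prodF-cong : ∀ {n} m {f g : Fin m → Expr n} → (∀ j → f j ≈E g j) → prodF m f ≈E prodF m g
prodF-cong zero    f≈g pt = refl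
prodF-cong (suc m) {f} {g} f≈g =
  ⊗-cong {e = f zero} {g zero} {prodF m (f ∘ suc)} {prodF m (g ∘ suc)}
    (f≈g zero) (prodF-cong m (f≈g ∘ suc))

-- mulF is the multiplication of the monoid (ℕ, *, 1)², so prodF evaluates to a finite
-- product in that monoid, which is invariant under permutations of the factors.
module FractionProduct = CommutativeMonoidSum
  (commutativeMonoid *-1-commutativeMonoid *-1-commutativeMonoid)

eval-prodF : ∀ {n} pt m (f : Fin m → Expr n) →
  eval pt (prodF m f) ≡ FractionProduct.sum (λ j → eval pt (f j))
eval-prodF pt zero    f = refl
eval-prodF pt (suc m) f = cong (mulF (eval pt (f zero))) (eval-prodF pt m (λ j → f (suc j)))

prodF-permute : ∀ {n m} (σ : Permutation′ m) (f : Fin m → Expr n) →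
  prodF m (λ j → f (σ ⟨$⟩ʳ j)) ≈E prodF m f
prodF-permute {m = m} σ f pt
  rewrite eval-prodF pt m (λ j → f (σ ⟨$⟩ʳ j)) | eval-prodF pt m f
  with FractionProduct.sum-permute (λ j → eval pt (f j)) σ
... | p , q rewrite p | q = refl

monomial : ∀ {n} → (ℤ → ℕ) → LSeed n → Fin n → Expr n
monomial {n} part s k = prodF n (λ j → pow (clu s j) (part (mat s j k)))

-- ≈L unfolds to a product of function types, from which Agda cannot infer the
-- two seeds; wrapping it in a record makes them inferable.
infix 4 _≅_
record _≅_ {n} (s t : LSeed n) : Set where
  constructor ⟪_⟫
  field unwrap : s ≈L t
open _≅_

≅-refl : ∀ {n} {s : LSeed n} → s ≅ s
≅-refl = ⟪ (λ _ _ → refl) , (λ _ _ → refl) ⟫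

≅-sym : ∀ {n} {s t : LSeed n} → s ≅ t → t ≅ s
≅-sym ⟪ s≈t , B≡C ⟫ = ⟪ (λ i pt → sym (s≈t i pt)) , (λ i j → sym (B≡C i j)) ⟫

≅-trans : ∀ {n} {s t r : LSeed n} → s ≅ t → t ≅ r → s ≅ r
≅-trans {s = s} {t} {r} ⟪ s≈t , B≡C ⟫ ⟪ t≈r , C≡D ⟫ = ⟪
  (λ i → ≈E-trans {e = clu s i} {clu t i} {clu r i} (s≈t i) (t≈r i)) ,
  (λ i j → trans (B≡C i j) (C≡D i j)) ⟫

LSeed-setoid : ℕ → Setoid _ _
LSeed-setoid n = record
  { Carrier       = LSeed n
  ; _≈_           = _≅_
  ; isEquivalence = record { refl = ≅-refl ; sym = ≅-sym ; trans = ≅-trans }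
  }

module ≅-Reasoning {n : ℕ} = Relation.Binary.Reasoning.Setoid (LSeed-setoid n)

monomial-cong : ∀ {n} part k {s t : LSeed n} → s ≅ t → monomial part s k ≈E monomial part t k
monomial-cong {n} part k {s} {t} ⟪ s≈t , B≡C ⟫ =
  prodF-cong n {λ j → pow (clu s j) (part (mat s j k))} {λ j → pow (clu t j) (part (mat t j k))}
    λ j → subst (λ b → pow (clu s j) (part (mat s j k)) ≈E pow (clu t j) (part b)) (B≡C j k)
            (pow-cong (part (mat s j k)) (s≈t j))

monomial-permute : ∀ {n} part σ k (s : LSeed n) →
  monomial part (permute σ s) k ≈E monomial part s (σ ⟨$⟩ʳ k)
monomial-permute part σ k s = prodF-permute σ (λ j → pow (clu s j) (part (mat s j (σ ⟨$⟩ʳ k))))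

exchanged : ∀ {n} → LSeed n → Fin n → Expr n
exchanged s k = (monomial posPart s k ⊕ monomial negPart s k) ⊘ clu s k

exchanged-cong : ∀ {n} k {s t : LSeed n} → s ≅ t → exchanged s k ≈E exchanged t k
exchanged-cong k {s} {t} s≈t =
  ⊘-cong {e = monomial posPart s k ⊕ monomial negPart s k}
         {monomial posPart t k ⊕ monomial negPart t k} {clu s k} {clu t k}
    (⊕-cong {e = monomial posPart s k} {monomial posPart t k}
            {monomial negPart s k} {monomial negPart t k}
       (monomial-cong posPart k s≈t) (monomial-cong negPart k s≈t))
    (proj₁ (unwrap s≈t) k)

exchanged-permute : ∀ {n} σ k (s : LSeed n) →
  exchanged (permute σ s) k ≈E exchanged s (σ ⟨$⟩ʳ k)
exchanged-permute σ k s =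
  ⊘-cong {e = monomial posPart (permute σ s) k ⊕ monomial negPart (permute σ s) k}
         {monomial posPart s σk ⊕ monomial negPart s σk} {clu s σk} {clu s σk}
    (⊕-cong {e = monomial posPart (permute σ s) k} {monomial posPart s σk}
            {monomial negPart (permute σ s) k} {monomial negPart s σk}
       (monomial-permute posPart σ k s) (monomial-permute negPart σ k s))
    (λ _ → refl)
  where
  σk : Fin _
  σk = σ ⟨$⟩ʳ k

mutMat-cong : ∀ {n} k {B C : Matrix n} → (∀ i j → B i j ≡ C i j) →
  ∀ i j → mutMat k B i j ≡ mutMat k C i j
mutMat-cong k B≡C i j with i ≟ k | j ≟ k
... | yes _ | _     = cong ℤ.-_ (B≡C i j)
... | no _  | yes _ = cong ℤ.-_ (B≡C i j)
... | no _  | no _  rewrite B≡C i j | B≡C i k | B≡C k j = refl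

mutate-cong : ∀ {n} k {s t : LSeed n} → s ≅ t → mutate k s ≅ mutate k t
mutate-cong k {s} {t} s≅t@(⟪ s≈t , B≡C ⟫) = ⟪ mutClu-cong , mutMat-cong k B≡C ⟫
  where
  mutClu-cong : ∀ i → mutClu k s i ≈E mutClu k t i
  mutClu-cong i with i ≟ k
  ... | no _  = s≈t i
  ... | yes _ = exchanged-cong k s≅t

permute-injective : ∀ {n} (σ : Permutation′ n) {i j} → σ ⟨$⟩ʳ i ≡ σ ⟨$⟩ʳ j → i ≡ j
permute-injective σ = Injection.injective (↔⇒↣ σ)

mutMat-permute : ∀ {n} k σ (B : Matrix n) i j →
  mutMat k (λ i j → B (σ ⟨$⟩ʳ i) (σ ⟨$⟩ʳ j)) i j ≡ mutMat (σ ⟨$⟩ʳ k) B (σ ⟨$⟩ʳ i) (σ ⟨$⟩ʳ j)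
mutMat-permute k σ B i j with i ≟ k | j ≟ k | σ ⟨$⟩ʳ i ≟ σ ⟨$⟩ʳ k | σ ⟨$⟩ʳ j ≟ σ ⟨$⟩ʳ k
... | yes _   | _       | yes _  | _      = refl
... | yes i≡k | _       | no σi≢σk | _    = ⊥-elim (σi≢σk (cong (σ ⟨$⟩ʳ_) i≡k))
... | no i≢k  | _       | yes σi≡σk | _   = ⊥-elim (i≢k (permute-injective σ σi≡σk))
... | no _    | yes _   | no _   | yes _  = refl
... | no _    | yes j≡k | no _   | no σj≢σk = ⊥-elim (σj≢σk (cong (σ ⟨$⟩ʳ_) j≡k))
... | no _    | no j≢k  | no _   | yes σj≡σk = ⊥-elim (j≢k (permute-injective σ σj≡σk))
... | no _    | no _    | no _   | no _   = refl

mutate-permute : ∀ {n} k σ (s : LSeed n) →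
  mutate k (permute σ s) ≅ permute σ (mutate (σ ⟨$⟩ʳ k) s)
mutate-permute k σ s = ⟪ mutClu-permute , mutMat-permute k σ (mat s) ⟫
  where
  mutClu-permute : ∀ i → mutClu k (permute σ s) i ≈E mutClu (σ ⟨$⟩ʳ k) s (σ ⟨$⟩ʳ i)
  mutClu-permute i with i ≟ k | σ ⟨$⟩ʳ i ≟ σ ⟨$⟩ʳ k
  ... | yes refl | yes _     = exchanged-permute σ i s
  ... | yes refl | no σi≢σi  = ⊥-elim (σi≢σi refl)
  ... | no i≢k   | yes σi≡σk = ⊥-elim (i≢k (permute-injective σ σi≡σk))
  ... | no _     | no _      = λ _ → refl

permute-cong : ∀ {n} σ {s t : LSeed n} → s ≅ t → permute σ s ≅ permute σ t
permute-cong σ ⟪ s≈t , B≡C ⟫ = ⟪ (λ i → s≈t (σ ⟨$⟩ʳ i)) , (λ i j → B≡C (σ ⟨$⟩ʳ i) (σ ⟨$⟩ʳ j)) ⟫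

mutateSeq-cong : ∀ {n} ks {s t : LSeed n} → s ≅ t → mutateSeq ks s ≅ mutateSeq ks t
mutateSeq-cong []       s≅t = s≅t
mutateSeq-cong (k ∷ ks) s≅t = mutateSeq-cong ks (mutate-cong k s≅t)

mutateSeq-∷ʳ : ∀ {n} ks k (s : LSeed n) → mutateSeq (ks ∷ʳ k) s ≡ mutate k (mutateSeq ks s)
mutateSeq-∷ʳ ks k s = foldl-∷ʳ (λ t k → mutate k t) s k ks

unwrap-⇔ : ∀ {n} {s t s′ t′ : LSeed n} → (s ≅ t) ⇔ (s′ ≅ t′) → (s ≈L t) ⇔ (s′ ≈L t′)
unwrap-⇔ s≅t⇔s′≅t′ = mk⇔ (unwrap ∘ Equivalence.to s≅t⇔s′≅t′ ∘ ⟪_⟫)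
                          (unwrap ∘ Equivalence.from s≅t⇔s′≅t′ ∘ ⟪_⟫)

relabelling-resp : ∀ {n} σ {s s′ t t′ : LSeed n} → s ≅ s′ → t ≅ t′ →
  (t ≅ permute σ s) ⇔ (t′ ≅ permute σ s′)
relabelling-resp σ s≅s′ t≅t′ = mk⇔
  (λ t≅σs → ≅-trans (≅-sym t≅t′) (≅-trans t≅σs (permute-cong σ s≅s′)))
  (λ t′≅σs′ → ≅-trans t≅t′ (≅-trans t′≅σs′ (permute-cong σ (≅-sym s≅s′))))

module _ {n : ℕ} {B0 : Matrix n} where

  private
    seedAt : LVertex n B0 → LSeed n
    seedAt = seedOf n B0

  -- (ks , σ) denotes permute σ (mutateSeq ks s₀): mutating it at k mutates the
  -- underlying unrelabelled seed at σ k.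
  mutateVertex : Fin n → LVertex n B0 → LVertex n B0
  mutateVertex k (ks , σ) = ks ∷ʳ (σ ⟨$⟩ʳ k) , σ

  mutateSeqVertex : List (Fin n) → LVertex n B0 → LVertex n B0
  mutateSeqVertex ks v = foldl (λ w k → mutateVertex k w) v ks

  relabelVertex : Permutation′ n → LVertex n B0 → LVertex n B0
  relabelVertex σ (ks , τ) = ks , σ ∘ₚ τ

  seedOf-mutateVertex : ∀ k v → seedAt (mutateVertex k v) ≅ mutate k (seedAt v)
  seedOf-mutateVertex k (ks , σ) = begin
    permute σ (mutateSeq (ks ∷ʳ (σ ⟨$⟩ʳ k)) s₀)     ≡⟨ cong (permute σ) (mutateSeq-∷ʳ ks (σ ⟨$⟩ʳ k) s₀) ⟩
    permute σ (mutate (σ ⟨$⟩ʳ k) (mutateSeq ks s₀)) ≈⟨ ≅-sym (mutate-permute k σ (mutateSeq ks s₀)) ⟩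
    mutate k (permute σ (mutateSeq ks s₀))          ∎
    where
    open ≅-Reasoning
    s₀ : LSeed n
    s₀ = initSeed n B0

  seedOf-mutateSeqVertex : ∀ ks v → seedAt (mutateSeqVertex ks v) ≅ mutateSeq ks (seedAt v)
  seedOf-mutateSeqVertex []       v = ≅-refl
  seedOf-mutateSeqVertex (k ∷ ks) v =
    ≅-trans (seedOf-mutateSeqVertex ks (mutateVertex k v))
            (mutateSeq-cong ks (seedOf-mutateVertex k v))

  seedOf-relabelVertex : ∀ σ v → seedAt (relabelVertex σ v) ≅ permute σ (seedAt v)
  seedOf-relabelVertex σ v = ≅-refl

  module _ {φ : Iso (ExchangeGraph n B0) (ExchangeGraph n B0)} (lift : InducedLift n B0 φ) where
    open InducedLift lift

    Φ-mutateVertex : ∀ k v → seedAt (Φ (mutateVertex k v)) ≅ mutate k (seedAt (Φ v))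
    Φ-mutateVertex k v =
      ≅-sym ⟪ Φ-edge v (mutateVertex k v) k (unwrap (≅-sym (seedOf-mutateVertex k v))) ⟫

    Φ-mutateSeqVertex : ∀ ks v → seedAt (Φ (mutateSeqVertex ks v)) ≅ mutateSeq ks (seedAt (Φ v))
    Φ-mutateSeqVertex []       v = ≅-refl
    Φ-mutateSeqVertex (k ∷ ks) v =
      ≅-trans (Φ-mutateSeqVertex ks (mutateVertex k v)) (mutateSeq-cong ks (Φ-mutateVertex k v))

    Φ-reflects-≅ : ∀ v w → seedAt (Φ v) ≅ seedAt (Φ w) → seedAt v ≅ seedAt w
    Φ-reflects-≅ v w Φv≅Φw = begin
      seedAt v         ≈⟨ ≅-sym ⟪ ΨΦ v ⟫ ⟩
      seedAt (Ψ (Φ v)) ≈⟨ ⟪ Ψ-cong (Φ v) (Φ w) (unwrap Φv≅Φw) ⟫ ⟩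
      seedAt (Ψ (Φ w)) ≈⟨ ⟪ ΨΦ w ⟫ ⟩
      seedAt w         ∎
      where open ≅-Reasoning

    Φ-relabelling : ∀ v w σ →
      (seedAt w ≅ permute σ (seedAt v)) ⇔ (seedAt (Φ w) ≅ permute σ (seedAt (Φ v)))
    Φ-relabelling v w σ = mk⇔
      (λ w≅σv → ≅-sym ⟪ Φ-perm v w σ (unwrap (≅-sym w≅σv)) ⟫)
      (λ Φw≅σΦv → ≅-trans (Φ-reflects-≅ w σv (≅-trans Φw≅σΦv Φσv≅ΦσΦv)) (seedOf-relabelVertex σ v))
      where
      σv : LVertex n B0
      σv = relabelVertex σ v
      Φσv≅ΦσΦv : permute σ (seedAt (Φ v)) ≅ seedAt (Φ σv)
      Φσv≅ΦσΦv = ⟪ Φ-perm v σv σ (unwrap (≅-sym (seedOf-relabelVertex σ v))) ⟫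

    Φ-relabelling-mutateSeq : ∀ u ks ls σ →
      (mutateSeq ls (seedAt u) ≈L permute σ (mutateSeq ks (seedAt u))) ⇔
      (mutateSeq ls (seedAt (Φ u)) ≈L permute σ (mutateSeq ks (seedAt (Φ u))))
    Φ-relabelling-mutateSeq u ks ls σ = unwrap-⇔ (
      relabelling-resp σ (Φ-mutateSeqVertex ks u) (Φ-mutateSeqVertex ls u)
      ⇔-∘ (Φ-relabelling (mutateSeqVertex ks u) (mutateSeqVertex ls u) σ
      ⇔-∘ relabelling-resp σ (≅-sym (seedOf-mutateSeqVertex ks u))
                              (≅-sym (seedOf-mutateSeqVertex ls u))))

    Φ-relabelling-mutate : ∀ u ks ls k σ →
      (mutateSeq ls (seedAt u) ≈L permute σ (mutate k (mutateSeq ks (seedAt u)))) ⇔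
      (mutateSeq ls (seedAt (Φ u)) ≈L permute σ (mutate k (mutateSeq ks (seedAt (Φ u)))))
    Φ-relabelling-mutate u ks ls k σ =
      subst₂ (λ s t → (mutateSeq ls (seedAt u) ≈L permute σ s) ⇔
                      (mutateSeq ls (seedAt (Φ u)) ≈L permute σ t))
        (mutateSeq-∷ʳ ks k (seedAt u)) (mutateSeq-∷ʳ ks k (seedAt (Φ u)))
        (Φ-relabelling-mutateSeq u (ks ∷ʳ k) ls σ)

lemma5p11 : (n : ℕ) (B0 : Matrix n) → SkewSymmetrizable B0 →
    StandingAssumption n B0 →
    (φ : Iso (ExchangeGraph n B0) (ExchangeGraph n B0)) →
    (lift : InducedLift n B0 φ) →
    (u : LVertex n B0) (a b : Fin n) → a ≢ b →
    Iso (GeodesicLoop n B0 u a b)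
        (GeodesicLoop n B0 (InducedLift.Φ lift u) a b)
lemma5p11 n B0 _ _ φ lift u a b _ = record
  { to        = id
  ; from      = id
  ; to-cong   = λ { {p} {q} (σ , fixes , h) → σ , fixes , to (relabelling p q σ) h }
  ; from-cong = λ { {p} {q} (σ , fixes , h) → σ , fixes , from (relabelling p q σ) h }
  ; from-to   = λ _ → idₚ , (λ _ _ _ → refl) , (λ _ _ → refl) , (λ _ _ → refl)
  ; to-from   = λ _ → idₚ , (λ _ _ _ → refl) , (λ _ _ → refl) , (λ _ _ → refl)
  ; adj-to    = λ { p q (σ , fixes , inj₁ h) → σ , fixes , inj₁ (to (mutation p q a σ) h)
                  ; p q (σ , fixes , inj₂ h) → σ , fixes , inj₂ (to (mutation p q b σ) h) }
  ; adj-to⁻   = λ { p q (σ , fixes , inj₁ h) → σ , fixes , inj₁ (from (mutation p q a σ) h)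
                  ; p q (σ , fixes , inj₂ h) → σ , fixes , inj₂ (from (mutation p q b σ) h) }
  }
  where
  open Equivalence

  path : List Bool → List (Fin n)
  path = map (λ c → if c then a else b)

  loopSeed : LVertex n B0 → List Bool → LSeed n
  loopSeed v p = mutateSeq (path p) (seedOf n B0 v)

  relabelling : ∀ p q σ →
    (loopSeed u q ≈L permute σ (loopSeed u p)) ⇔
    (loopSeed (InducedLift.Φ lift u) q ≈L permute σ (loopSeed (InducedLift.Φ lift u) p))
  relabelling p q = Φ-relabelling-mutateSeq lift u (path p) (path q)

  mutation : ∀ p q k σ →
    (loopSeed u q ≈L permute σ (mutate k (loopSeed u p))) ⇔
    (loopSeed (InducedLift.Φ lift u) q ≈L permute σ (mutate k (loopSeed (InducedLift.Φ lift u) p)))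
  mutation p q = Φ-relabelling-mutate lift u (path p) (path q)
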